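{- Let $d\ge0$, $\mathbb{F}$ a field, $V$ an $\mathbb{F}$-vector space of dimension $d+1$, and $B$ a Billiard Array on $V$. Let $\{u_i\}_{i=0}^d$ and $\{v_i\}_{i=0}^d$ be bases of $V$ with $u_i\in B_{(d-i,i,0)}$ and $v_i\in B_{(d-i,0,i)}$ for $0\le i\le d$, and let $T\in{\rm Mat}_{d+1}(\mathbb{F})$ be the transition matrix from $\{u_i\}$ to $\{v_i\}$, i.e. $v_j=\sum_{i=0}^dT_{ij}u_i$. Then $T$ is very good.
   Context: Matrices are indexed by $0,\dots,d$; for $0\le i\le j\le d$, $T[i,j]$ is the submatrix with rows $0,\dots,j-i$ and columns $i,\dots,j$; $T$ is very good if every $T[i,j]$ is invertible. $\Delta_d=\{(r,s,t)\in\mathbb{N}^3:r+s+t=d\}$. A line in $\Delta_d$ is a set of elements with a fixed $\eta$-coordinate for some $\eta\in\{1,2,3\}$. A black 3-clique is a set $\{(a+1,b,c),(a,b+1,c),(a,b,c+1)\}$ with $(a,b,c)\in\Delta_{d-1}$. A Billiard Array on $V$ is a map $\lambda\mapsto B_\lambda$ from $\Delta_d$ to the set of 1-dimensional subspaces of $V$ such that for each line $L$ the sum $\sum_{\lambda\in L}B_\lambda$ is direct, and for each black 3-clique $C$ the sum $\sum_{\lambda\in C}B_\lambda$ is not direct. -}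

module Defs where

open import Level using (Level; _⊔_) renaming (suc to lsuc)
open import Algebra.Bundles using (CommutativeRing)
open import Algebra.Module.Bundles using (Module)
open import Data.Nat using (ℕ; zero; suc; _+_; _∸_; _≤_; _<_; s≤s; z≤n)
open import Data.Nat.Properties
  using (+-identityʳ; m+[n∸m]≡n; m∸n≤m; ≤-trans; +-monoʳ-≤; +-assoc; +-suc)
open import Data.Fin using (Fin; toℕ; fromℕ<)
open import Data.Fin.Properties using (toℕ<n)
open import Data.Product using (Σ; ∃; _×_; _,_)
open import Data.Sum using (_⊎_)
open import Relation.Binary.PropositionalEquality using (_≡_; refl; sym; trans; cong)
open import Relation.Nullary using (¬_)
open import Function.Bundles using (_⇔_)

record IsField {c ℓ : Level} (F : CommutativeRing c ℓ) : Set (c ⊔ ℓ) where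
  open CommutativeRing F
  field
    1≉0     : ¬ (1# ≈ 0#)
    zeroOrInvertible : ∀ x → (x ≈ 0#) ⊎ (∃ λ y → x * y ≈ 1#)

record Δ (d : ℕ) : Set where
  constructor ⟨_,_,_∣_⟩
  field
    r s t : ℕ
    sum   : r + s + t ≡ d

private
  split : ∀ c d k → c ≤ d → k ≤ d ∸ c → c + k + ((d ∸ c) ∸ k) ≡ d
  split c d k c≤d k≤ = trans (+-assoc c k ((d ∸ c) ∸ k))
    (trans (cong (c +_) (m+[n∸m]≡n k≤)) (m+[n∸m]≡n c≤d))

  ≤-pred : ∀ {k n} → k < suc n → k ≤ n
  ≤-pred (s≤s p) = p

data Coord : Set where
  η₁ η₂ η₃ : Coord

line : ∀ {d} → Coord → (c : ℕ) → c ≤ d → Fin (suc (d ∸ c)) → Δ d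
line {d} η₁ c c≤d k =
  ⟨ c , toℕ k , (d ∸ c) ∸ toℕ k ∣ split c d (toℕ k) c≤d (≤-pred (toℕ<n k)) ⟩
line {d} η₂ c c≤d k =
  ⟨ (d ∸ c) ∸ toℕ k , c , toℕ k ∣ p ⟩
  where
    a = (d ∸ c) ∸ toℕ k
    p : a + c + toℕ k ≡ d
    p = trans (cong (_+ toℕ k) (+-comm' a c))
          (trans (+-assoc c a (toℕ k))
            (trans (cong (c +_) (+-comm' a (toℕ k)))
              (trans (sym (+-assoc c (toℕ k) a))
                (split c d (toℕ k) c≤d (≤-pred (toℕ<n k))))))
      where open import Data.Nat.Properties using () renaming (+-comm to +-comm')
line {d} η₃ c c≤d k =
  ⟨ toℕ k , (d ∸ c) ∸ toℕ k , c ∣ p ⟩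
  where
    a = (d ∸ c) ∸ toℕ k
    open import Data.Nat.Properties using () renaming (+-comm to +-comm')
    p : toℕ k + a + c ≡ d
    p = trans (+-comm' (toℕ k + a) c)
          (trans (sym (+-assoc c (toℕ k) a))
            (split c d (toℕ k) c≤d (≤-pred (toℕ<n k))))

-- The black 3-clique {(a+1,b,c),(a,b+1,c),(a,b,c+1)} for (a,b,c) ∈ Δ_{d-1},
-- i.e. a + b + c + 1 = d, enumerated by Fin 3.
clique : ∀ {d} (a b c : ℕ) → suc (a + b + c) ≡ d → Fin 3 → Δ d
clique a b c p Fin.zero = ⟨ suc a , b , c ∣ p ⟩
  where import Data.Fin as Fin
clique a b c p (Fin.suc Fin.zero) = ⟨ a , suc b , c ∣ trans (cong (_+ c) (+-suc a b)) p ⟩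
  where import Data.Fin as Fin
clique a b c p (Fin.suc (Fin.suc Fin.zero)) =
  ⟨ a , b , suc c ∣ trans (+-suc (a + b) c) p ⟩
  where import Data.Fin as Fin

pt-rs : ∀ {d} → Fin (suc d) → Δ d
pt-rs {d} i = ⟨ d ∸ toℕ i , toℕ i , 0 ∣ trans (+-identityʳ _)
  (trans (+-comm' (d ∸ toℕ i) (toℕ i)) (m+[n∸m]≡n (≤-pred (toℕ<n i)))) ⟩
  where open import Data.Nat.Properties using () renaming (+-comm to +-comm')

pt-rt : ∀ {d} → Fin (suc d) → Δ d
pt-rt {d} i = ⟨ d ∸ toℕ i , 0 , toℕ i ∣ trans (cong (_+ toℕ i) (+-identityʳ _))
  (trans (+-comm' (d ∸ toℕ i) (toℕ i)) (m+[n∸m]≡n (≤-pred (toℕ<n i)))) ⟩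
  where open import Data.Nat.Properties using () renaming (+-comm to +-comm')

module LinAlg {c ℓ m ℓm : Level} (F : CommutativeRing c ℓ) (M : Module F m ℓm) where
  open CommutativeRing F using (Carrier; _≈_; 0#; 1#) renaming (_+_ to _+F_; _*_ to _*F_)
  open Module M using (Carrierᴹ; _≈ᴹ_; _+ᴹ_; _*ₗ_; 0ᴹ)

  ∑ : ∀ n → (Fin n → Carrier) → Carrier
  ∑ zero    f = 0#
  ∑ (suc n) f = f Fin.zero +F ∑ n (λ i → f (Fin.suc i))
    where import Data.Fin as Fin

  ∑ᴹ : ∀ n → (Fin n → Carrierᴹ) → Carrierᴹ
  ∑ᴹ zero    f = 0ᴹ
  ∑ᴹ (suc n) f = f Fin.zero +ᴹ ∑ᴹ n (λ i → f (Fin.suc i))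
    where import Data.Fin as Fin

  LinIndependent : ∀ {n} → (Fin n → Carrierᴹ) → Set (c ⊔ ℓ ⊔ ℓm)
  LinIndependent {n} e =
    ∀ (a : Fin n → Carrier) → ∑ᴹ n (λ i → a i *ₗ e i) ≈ᴹ 0ᴹ → ∀ i → a i ≈ 0#

  Spanning : ∀ {n} → (Fin n → Carrierᴹ) → Set (c ⊔ m ⊔ ℓm)
  Spanning {n} e = ∀ (x : Carrierᴹ) → ∃ λ (a : Fin n → Carrier) → x ≈ᴹ ∑ᴹ n (λ i → a i *ₗ e i)

  IsBasis : ∀ {n} → (Fin n → Carrierᴹ) → Set (c ⊔ ℓ ⊔ m ⊔ ℓm)
  IsBasis e = LinIndependent e × Spanning e

  HasDimension : ℕ → Set (c ⊔ ℓ ⊔ m ⊔ ℓm)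
  HasDimension n = ∃ λ (e : Fin n → Carrierᴹ) → IsBasis e

  record Subspace : Set (lsuc (c ⊔ m ⊔ ℓm)) where
    field
      _∈S    : Carrierᴹ → Set (c ⊔ m ⊔ ℓm)
      ∈-resp : ∀ {x y} → x ≈ᴹ y → x ∈S → y ∈S
      0∈     : 0ᴹ ∈S
      +∈     : ∀ {x y} → x ∈S → y ∈S → (x +ᴹ y) ∈S
      *∈     : ∀ a {x} → x ∈S → (a *ₗ x) ∈S

  record OneDimSubspace : Set (lsuc (c ⊔ m ⊔ ℓm)) where
    field
      subspace : Subspace
      gen      : Carrierᴹ
      gen≉0    : ¬ (gen ≈ᴹ 0ᴹ)
      spanned  : ∀ x → Subspace._∈S subspace x ⇔ (∃ λ a → x ≈ᴹ a *ₗ gen)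
    open Subspace subspace public

  _∈₁_ : Carrierᴹ → OneDimSubspace → Set (c ⊔ m ⊔ ℓm)
  x ∈₁ W = OneDimSubspace._∈S W x

  IsDirectSum : ∀ {n} → (Fin n → Subspace) → Set (c ⊔ m ⊔ ℓm)
  IsDirectSum {n} W =
    ∀ (w : Fin n → Carrierᴹ) → (∀ i → Subspace._∈S (W i) (w i)) →
    ∑ᴹ n w ≈ᴹ 0ᴹ → ∀ i → w i ≈ᴹ 0ᴹ

  record IsBilliardArray (d : ℕ) (B : Δ d → OneDimSubspace) : Set (c ⊔ m ⊔ ℓm) where
    field
      lines-direct : ∀ (η : Coord) (x : ℕ) (x≤d : x ≤ d) →
        IsDirectSum (λ k → OneDimSubspace.subspace (B (line η x x≤d k)))
      cliques-not-direct : ∀ (a b e : ℕ) (p : suc (a + b + e) ≡ d) →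
        ¬ IsDirectSum (λ k → OneDimSubspace.subspace (B (clique a b e p k)))

  Matrix : ℕ → Set c
  Matrix n = Fin n → Fin n → Carrier

  _·_ : ∀ {n} → Matrix n → Matrix n → Matrix n
  _·_ {n} X Y i j = ∑ n (λ k → X i k *F Y k j)

  I : ∀ {n} → Matrix n
  I {n} i j with i Data.Fin.≟ j
    where import Data.Fin
  ... | Relation.Nullary.yes _ = 1#
    where import Relation.Nullary
  ... | Relation.Nullary.no  _ = 0#
    where import Relation.Nullary

  _≈M_ : ∀ {n} → Matrix n → Matrix n → Set ℓ
  X ≈M Y = ∀ i j → X i j ≈ Y i j

  Invertible : ∀ {n} → Matrix n → Set (c ⊔ ℓ)
  Invertible {n} X = ∃ λ (Y : Matrix n) → ((X · Y) ≈M I) × ((Y · X) ≈M I)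

  -- T[i,j] for i ≤ j: rows 0,…,j−i and columns i,…,j of T
  private
    row< : ∀ {d i j} (r : Fin (suc (toℕ {suc d} j ∸ toℕ {suc d} i))) → toℕ r < suc d
    row< {d} {i} {j} r = ≤-trans (toℕ<n r) (s≤s (≤-trans (m∸n≤m (toℕ j) (toℕ i)) (≤-pred (toℕ<n j))))

    col< : ∀ {d i j} → toℕ {suc d} i ≤ toℕ {suc d} j →
           (r : Fin (suc (toℕ {suc d} j ∸ toℕ {suc d} i))) → toℕ i + toℕ r < suc d
    col< {d} {i} {j} i≤j r =
      ≤-trans (s≤s (≤-trans (+-monoʳ-≤ (toℕ i) (≤-pred (toℕ<n r)))
                            (Data.Nat.Properties.≤-reflexive (m+[n∸m]≡n i≤j))))
              (toℕ<n j)
      where import Data.Nat.Properties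

  sub : ∀ {d} → Matrix (suc d) → (i j : Fin (suc d)) → toℕ i ≤ toℕ j →
        Matrix (suc (toℕ j ∸ toℕ i))
  sub {d} T i j i≤j r s =
    T (fromℕ< (row< {d} {i} {j} r)) (fromℕ< (col< {d} {i} {j} i≤j s))

  VeryGood : ∀ {d} → Matrix (suc d) → Set (c ⊔ ℓ)
  VeryGood {d} T = ∀ (i j : Fin (suc d)) (i≤j : toℕ i ≤ toℕ j) → Invertible (sub T i j i≤j)

module Submission where

-- Fix 0 ≤ i ≤ j ≤ d, n = j − i, X = span{v_i,…,v_j}, W = span{u_{n+1},…,u_d}.
-- If u_0,…,u_n ∈ X + W, then expressing the first n+1 u-coordinates of
-- each u_a through the columns i,…,j of T gives C with T[i,j]·C = I, and
-- over a field a right inverse of a square matrix is two-sided.  The key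
-- local fact: the generators of a black 3-clique satisfy a linear relation
-- with all three coefficients nonzero (the clique sum is not direct, while
-- any two clique points lie on a line, whose sum is direct), so each of
-- them lies in X + W as soon as the other two do.  Starting from
-- B_(d-s,s,0) = F u_s ⊆ W for s > n and B_(d-t,0,t) = F v_t ⊆ X for
-- i ≤ t ≤ j, clique inductions show B_λ ⊆ X + W whenever λ_t ≤ i.

open import Defs
open import Level using (Level; _⊔_)
open import Algebra.Bundles using (CommutativeRing)
open import Algebra.Module.Bundles using (Module)
open import Data.Nat as ℕ using (ℕ; zero; suc; _∸_)
open import Data.Fin as Fin using (Fin; zero; suc; punchIn; punchOut; toℕ)
open import Data.Fin.Properties using (toℕ<n; toℕ-fromℕ<; punchInᵢ≢i; toℕ-injective; punchIn-punchOut)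
open import Data.Vec.Functional using (insertAt)
open import Data.Vec.Functional.Properties using (insertAt-lookup; insertAt-punchIn)
import Data.Nat.Properties as NatProps
open import Relation.Nullary using (¬_; yes; no)
open import Data.Empty using (⊥-elim)
open import Relation.Binary.PropositionalEquality as P using (_≡_; _≢_)
import Relation.Binary.Reasoning.Setoid as SetoidReasoning
import Algebra.Properties.Semiring.Sum as SemiringSum
import Algebra.Properties.CommutativeMonoid.Sum as MonoidSum
import Algebra.Properties.CommutativeSemigroup as CommSemigroupProps
import Algebra.Properties.Group as GroupProps
import Algebra.Properties.Ring as RingProps
open import Data.Sum using (_⊎_; inj₁; inj₂)
open import Function using (_∘_)
open import Function.Bundles using (Equivalence)
open import Data.Product using (∃; _×_; _,_; proj₁; proj₂)

-- The η₁-line through p (fixed r) lists its points by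
-- their s-coordinate; rotating (r,s,t) ↦ (s,t,r) turns the η₂- and
-- η₃-lines into this form, so one notion of 'slot' locates a point on
-- each of the three lines through it.
module Simplex where
  open import Data.Nat using (_+_)

  Δ-≡ : ∀ {d r s t r′ s′ t′} {e : r + s + t ≡ d} {e′ : r′ + s′ + t′ ≡ d} →
        r ≡ r′ → s ≡ s′ → t ≡ t′ → ⟨ r , s , t ∣ e ⟩ ≡ ⟨ r′ , s′ , t′ ∣ e′ ⟩
  Δ-≡ {e = e} {e′} P.refl P.refl P.refl = P.cong ⟨ _ , _ , _ ∣_⟩ (NatProps.≡-irrelevant e e′)

  rotate : ∀ {d} → Δ d → Δ d
  rotate ⟨ r , s , t ∣ e ⟩ = ⟨ s , t , r ∣ P.trans (NatProps.+-comm (s + t) r) (P.trans (P.sym (NatProps.+-assoc r s t)) e) ⟩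

  r≤d : ∀ {d} (p : Δ d) → Δ.r p ℕ.≤ d
  r≤d ⟨ r , s , t ∣ e ⟩ = P.subst (r ℕ.≤_) (P.trans (P.sym (NatProps.+-assoc r s t)) e) (NatProps.m≤m+n r (s + t))

  d∸r : ∀ {d} (p : Δ d) → d ∸ Δ.r p ≡ Δ.s p + Δ.t p
  d∸r ⟨ r , s , t ∣ e ⟩ = P.trans (P.cong (_∸ r) (P.trans (P.sym e) (NatProps.+-assoc r s t))) (NatProps.m+n∸m≡n r (s + t))

  slot : ∀ {d} (p : Δ d) → Fin (suc (d ∸ Δ.r p))
  slot p = Fin.fromℕ< (ℕ.s≤s (P.subst (Δ.s p ℕ.≤_) (P.sym (d∸r p)) (NatProps.m≤m+n (Δ.s p) (Δ.t p))))

  toℕ-slot : ∀ {d} (p : Δ d) → toℕ (slot p) ≡ Δ.s p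
  toℕ-slot p = toℕ-fromℕ< _

  rest-slot : ∀ {d} (p : Δ d) → (d ∸ Δ.r p) ∸ toℕ (slot p) ≡ Δ.t p
  rest-slot p = P.trans (P.cong₂ _∸_ (d∸r p) (toℕ-slot p)) (NatProps.m+n∸m≡n (Δ.s p) (Δ.t p))

  on-line₁ : ∀ {d} (p : Δ d) (r≤ : Δ.r p ℕ.≤ d) → line η₁ (Δ.r p) r≤ (slot p) ≡ p
  on-line₁ p@(⟨ _ , _ , _ ∣ _ ⟩) r≤ = Δ-≡ P.refl (toℕ-slot p) (rest-slot p)

  on-line₂ : ∀ {d} (p : Δ d) (s≤ : Δ.s p ℕ.≤ d) → line η₂ (Δ.s p) s≤ (slot (rotate p)) ≡ p
  on-line₂ p@(⟨ _ , _ , _ ∣ _ ⟩) s≤ = Δ-≡ (rest-slot (rotate p)) P.refl (toℕ-slot (rotate p))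

  on-line₃ : ∀ {d} (p : Δ d) (t≤ : Δ.t p ℕ.≤ d) → line η₃ (Δ.t p) t≤ (slot (rotate (rotate p))) ≡ p
  on-line₃ p@(⟨ _ , _ , _ ∣ _ ⟩) t≤ = Δ-≡ (toℕ-slot (rotate (rotate p))) (rest-slot (rotate (rotate p))) P.refl

  slots-differ : ∀ {d} (p q : Δ d) → Δ.s p ≢ Δ.s q → toℕ (slot p) ≢ toℕ (slot q)
  slots-differ p q s≢ same = s≢ (P.trans (P.sym (toℕ-slot p)) (P.trans same (toℕ-slot q)))

module Sums {c ℓ m ℓm : Level} (F : CommutativeRing c ℓ) (V : Module F m ℓm) where
  open CommutativeRing F hiding (zero)
  open Module V
  open LinAlg F V
  open RingProps ring using (-1*x≈-x)
  open SemiringSum semiring using (sum; sum-cong-≋; sum-replicate-zero; ∑-distrib-+; ∑-comm;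
                                   sum-remove; *-distribˡ-sum; sum-cong-≗)
  private module ∑ᴹ-lib = MonoidSum +ᴹ-commutativeMonoid
  open SetoidReasoning setoid

  ∑≡sum : ∀ n (f : Fin n → Carrier) → ∑ n f ≡ sum f
  ∑≡sum zero    f = P.refl
  ∑≡sum (suc n) f = P.cong (f zero +_) (∑≡sum n (λ i → f (suc i)))

  ∑ᴹ≡sum : ∀ n (f : Fin n → Carrierᴹ) → ∑ᴹ n f ≡ ∑ᴹ-lib.sum f
  ∑ᴹ≡sum zero    f = P.refl
  ∑ᴹ≡sum (suc n) f = P.cong (f zero +ᴹ_) (∑ᴹ≡sum n (λ i → f (suc i)))

  ∑-cong : ∀ n {f g : Fin n → Carrier} → (∀ i → f i ≈ g i) → ∑ n f ≈ ∑ n g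
  ∑-cong n {f} {g} f≈g rewrite ∑≡sum n f | ∑≡sum n g = sum-cong-≋ f≈g

  ∑-zero : ∀ n {f : Fin n → Carrier} → (∀ i → f i ≈ 0#) → ∑ n f ≈ 0#
  ∑-zero n {f} f≈0 rewrite ∑≡sum n f = trans (sum-cong-≋ f≈0) (sum-replicate-zero n)

  ∑-+ : ∀ n (f g : Fin n → Carrier) → ∑ n (λ i → f i + g i) ≈ ∑ n f + ∑ n g
  ∑-+ n f g rewrite ∑≡sum n (λ i → f i + g i) | ∑≡sum n f | ∑≡sum n g = ∑-distrib-+ f g

  ∑-*ˡ : ∀ n x (f : Fin n → Carrier) → ∑ n (λ i → x * f i) ≈ x * ∑ n f
  ∑-*ˡ n x f rewrite ∑≡sum n (λ i → x * f i) | ∑≡sum n f = sym (*-distribˡ-sum x f)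

  ∑-*ʳ : ∀ n x (f : Fin n → Carrier) → ∑ n (λ i → f i * x) ≈ ∑ n f * x
  ∑-*ʳ n x f = begin
    ∑ n (λ i → f i * x) ≈⟨ ∑-cong n (λ i → *-comm (f i) x) ⟩
    ∑ n (λ i → x * f i) ≈⟨ ∑-*ˡ n x f ⟩
    x * ∑ n f           ≈⟨ *-comm x _ ⟩
    ∑ n f * x           ∎

  ∑-swap : ∀ m n (f : Fin m → Fin n → Carrier) →
           ∑ m (λ i → ∑ n (f i)) ≈ ∑ n (λ j → ∑ m (λ i → f i j))
  ∑-swap m n f = begin
    ∑ m (λ i → ∑ n (f i))            ≡⟨ P.trans (∑≡sum m _) (sum-cong-≗ (λ i → ∑≡sum n (f i))) ⟩
    sum (λ i → sum (f i))            ≈⟨ ∑-comm f ⟩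
    sum (λ j → sum (λ i → f i j))    ≡⟨ P.sym (P.trans (∑≡sum n _) (sum-cong-≗ (λ j → ∑≡sum m (λ i → f i j)))) ⟩
    ∑ n (λ j → ∑ m (λ i → f i j))    ∎

  ∑-extract : ∀ n (f : Fin (suc n) → Carrier) p → ∑ (suc n) f ≈ f p + ∑ n (λ q → f (punchIn p q))
  ∑-extract n f p rewrite ∑≡sum (suc n) f | ∑≡sum n (λ q → f (punchIn p q)) = sum-remove f

  ∑ᴹ-cong : ∀ n {f g : Fin n → Carrierᴹ} → (∀ i → f i ≈ᴹ g i) → ∑ᴹ n f ≈ᴹ ∑ᴹ n g
  ∑ᴹ-cong n {f} {g} f≈g rewrite ∑ᴹ≡sum n f | ∑ᴹ≡sum n g = ∑ᴹ-lib.sum-cong-≋ f≈g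

  ∑ᴹ-zero : ∀ n {f : Fin n → Carrierᴹ} → (∀ i → f i ≈ᴹ 0ᴹ) → ∑ᴹ n f ≈ᴹ 0ᴹ
  ∑ᴹ-zero n {f} f≈0 rewrite ∑ᴹ≡sum n f =
    ≈ᴹ-trans (∑ᴹ-lib.sum-cong-≋ f≈0) (∑ᴹ-lib.sum-replicate-zero n)

  ∑ᴹ-+ : ∀ n (f g : Fin n → Carrierᴹ) → ∑ᴹ n (λ i → f i +ᴹ g i) ≈ᴹ ∑ᴹ n f +ᴹ ∑ᴹ n g
  ∑ᴹ-+ n f g rewrite ∑ᴹ≡sum n (λ i → f i +ᴹ g i) | ∑ᴹ≡sum n f | ∑ᴹ≡sum n g = ∑ᴹ-lib.∑-distrib-+ f g

  ∑ᴹ-extract : ∀ n (f : Fin (suc n) → Carrierᴹ) p →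
               ∑ᴹ (suc n) f ≈ᴹ f p +ᴹ ∑ᴹ n (λ q → f (punchIn p q))
  ∑ᴹ-extract n f p rewrite ∑ᴹ≡sum (suc n) f | ∑ᴹ≡sum n (λ q → f (punchIn p q)) = ∑ᴹ-lib.sum-remove f

  ∑ᴹ-*ₗ : ∀ n x (f : Fin n → Carrierᴹ) → ∑ᴹ n (λ i → x *ₗ f i) ≈ᴹ x *ₗ ∑ᴹ n f
  ∑ᴹ-*ₗ zero    x f = ≈ᴹ-sym (*ₗ-zeroʳ x)
  ∑ᴹ-*ₗ (suc n) x f = ≈ᴹ-trans (+ᴹ-congˡ (∑ᴹ-*ₗ n x (λ i → f (suc i)))) (≈ᴹ-sym (*ₗ-distribˡ x _ _))

  δ-diag : ∀ {n} (p : Fin n) → I p p ≈ 1#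
  δ-diag p with p Fin.≟ p
  ... | yes _  = refl
  ... | no p≢p = ⊥-elim (p≢p P.refl)

  δ-off : ∀ {n} (p q : Fin n) → p ≢ q → I p q ≈ 0#
  δ-off p q p≢q with p Fin.≟ q
  ... | yes p≡q = ⊥-elim (p≢q p≡q)
  ... | no _    = refl

  δ-sym : ∀ {n} (p q : Fin n) → I p q ≈ I q p
  δ-sym p q with p Fin.≟ q | q Fin.≟ p
  ... | yes _   | yes _   = refl
  ... | no _    | no _    = refl
  ... | yes p≡q | no q≢p  = ⊥-elim (q≢p (P.sym p≡q))
  ... | no p≢q  | yes q≡p = ⊥-elim (p≢q (P.sym q≡p))

  δ-toℕ : ∀ {n n'} (p q : Fin n) (p' q' : Fin n') → toℕ p ≡ toℕ p' → toℕ q ≡ toℕ q' → I p q ≈ I p' q'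
  δ-toℕ p q p' q' p≡p' q≡q' with p Fin.≟ q | p' Fin.≟ q'
  ... | yes _      | yes _    = refl
  ... | no _       | no _     = refl
  ... | yes P.refl | no p'≢q' = ⊥-elim (p'≢q' (toℕ-injective (P.trans (P.sym p≡p') q≡q')))
  ... | no p≢q     | yes P.refl = ⊥-elim (p≢q (toℕ-injective (P.trans p≡p' (P.sym q≡q'))))

  ∑-δ : ∀ n (p : Fin n) (x : Fin n → Carrier) → ∑ n (λ k → I p k * x k) ≈ x p
  ∑-δ (suc n) p x = begin
    ∑ (suc n) (λ k → I p k * x k)                              ≈⟨ ∑-extract n (λ k → I p k * x k) p ⟩
    I p p * x p + ∑ n (λ q → I p (punchIn p q) * x (punchIn p q)) ≈⟨ +-cong diag (∑-zero n off) ⟩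
    x p + 0#                                                   ≈⟨ +-identityʳ _ ⟩
    x p                                                        ∎
    where
    diag : I p p * x p ≈ x p
    diag = trans (*-congʳ (δ-diag p)) (*-identityˡ _)
    off : ∀ q → I p (punchIn p q) * x (punchIn p q) ≈ 0#
    off q = trans (*-congʳ (δ-off p _ (λ e → punchInᵢ≢i p q (P.sym e)))) (zeroˡ _)

  ∑ᴹ-δ : ∀ n (p : Fin n) (x : Fin n → Carrierᴹ) → ∑ᴹ n (λ k → I p k *ₗ x k) ≈ᴹ x p
  ∑ᴹ-δ (suc n) p x =
    ≈ᴹ-trans (∑ᴹ-extract n (λ k → I p k *ₗ x k) p) (≈ᴹ-trans (+ᴹ-cong diag (∑ᴹ-zero n off)) (+ᴹ-identityʳ _))
    where
    diag : I p p *ₗ x p ≈ᴹ x p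
    diag = ≈ᴹ-trans (*ₗ-congʳ (δ-diag p)) (*ₗ-identityˡ _)
    off : ∀ q → I p (punchIn p q) *ₗ x (punchIn p q) ≈ᴹ 0ᴹ
    off q = ≈ᴹ-trans (*ₗ-congʳ (δ-off p _ (λ e → punchInᵢ≢i p q (P.sym e)))) (*ₗ-zeroˡ _)

  ∑-neg : ∀ n (f : Fin n → Carrier) → ∑ n (λ i → - f i) ≈ - ∑ n f
  ∑-neg n f = begin
    ∑ n (λ i → - f i)      ≈⟨ ∑-cong n (λ i → sym (-1*x≈-x (f i))) ⟩
    ∑ n (λ i → - 1# * f i) ≈⟨ ∑-*ˡ n (- 1#) f ⟩
    - 1# * ∑ n f           ≈⟨ -1*x≈-x _ ⟩
    - ∑ n f                ∎

  ∑-minus : ∀ n (f g : Fin n → Carrier) → ∑ n (λ i → f i - g i) ≈ ∑ n f - ∑ n g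
  ∑-minus n f g = trans (∑-+ n f (λ i → - g i)) (+-congˡ (∑-neg n g))

  ∑-combination : ∀ m n (b : Fin m → Carrier) (α : Fin m → Fin n → Carrier) (z : Fin n → Carrier) →
                  ∑ m (λ q → b q * ∑ n (λ k → α q k * z k)) ≈ ∑ n (λ k → ∑ m (λ q → b q * α q k) * z k)
  ∑-combination m n b α z = begin
    ∑ m (λ q → b q * ∑ n (λ k → α q k * z k))     ≈⟨ ∑-cong m (λ q → sym (∑-*ˡ n (b q) _)) ⟩
    ∑ m (λ q → ∑ n (λ k → b q * (α q k * z k)))   ≈⟨ ∑-swap m n _ ⟩
    ∑ n (λ k → ∑ m (λ q → b q * (α q k * z k)))   ≈⟨ ∑-cong n (λ k → ∑-cong m (λ q → sym (*-assoc _ _ _))) ⟩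
    ∑ n (λ k → ∑ m (λ q → b q * α q k * z k))     ≈⟨ ∑-cong n (λ k → ∑-*ʳ m (z k) _) ⟩
    ∑ n (λ k → ∑ m (λ q → b q * α q k) * z k)     ∎

  ·-assoc : ∀ {n} (A B C : Matrix n) → ((A · B) · C) ≈M (A · (B · C))
  ·-assoc {n} A B C i j = begin
    ∑ n (λ m → ∑ n (λ k → A i k * B k m) * C m j)   ≈⟨ ∑-cong n (λ m → sym (∑-*ʳ n (C m j) _)) ⟩
    ∑ n (λ m → ∑ n (λ k → A i k * B k m * C m j))   ≈⟨ ∑-swap n n _ ⟩
    ∑ n (λ k → ∑ n (λ m → A i k * B k m * C m j))   ≈⟨ ∑-cong n (λ k → ∑-cong n (λ m → *-assoc _ _ _)) ⟩
    ∑ n (λ k → ∑ n (λ m → A i k * (B k m * C m j))) ≈⟨ ∑-cong n (λ k → ∑-*ˡ n (A i k) _) ⟩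
    ∑ n (λ k → A i k * ∑ n (λ m → B k m * C m j))   ∎

  I·-identity : ∀ {n} (A : Matrix n) → (I · A) ≈M A
  I·-identity {n} A i j = ∑-δ n i (λ k → A k j)

  ·I-identity : ∀ {n} (A : Matrix n) → (A · I) ≈M A
  ·I-identity {n} A i j = trans (∑-cong n (λ k → trans (*-comm _ _) (*-congʳ (δ-sym k j)))) (∑-δ n j (A i))

  record LinearlyClosed {p} {N} (P : (Fin N → Carrier) → Set p) : Set (c ⊔ ℓ ⊔ p) where
    field
      resp        : ∀ {y y′} → (∀ l → y l ≈ y′ l) → P y → P y′
      combination : ∀ k (b : Fin k → Carrier) (y : Fin k → Fin N → Carrier) →
                    (∀ q → P (y q)) → P (λ l → ∑ k (λ q → b q * y q l))

    scale : ∀ a {y} → P y → P (λ l → a * y l)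
    scale a {y} Py = resp (λ l → +-identityʳ (a * y l)) (combination 1 (λ _ → a) (λ _ → y) (λ _ → Py))

  lc : ∀ n → (Fin n → Carrier) → (Fin n → Carrierᴹ) → Carrierᴹ
  lc n a e = ∑ᴹ n (λ i → a i *ₗ e i)

  lc-cong : ∀ n {a b : Fin n → Carrier} e → (∀ i → a i ≈ b i) → lc n a e ≈ᴹ lc n b e
  lc-cong n e a≈b = ∑ᴹ-cong n (λ i → *ₗ-congʳ (a≈b i))

  lc-zero : ∀ n {a : Fin n → Carrier} e → (∀ i → a i ≈ 0#) → lc n a e ≈ᴹ 0ᴹ
  lc-zero n e a≈0 = ∑ᴹ-zero n (λ i → ≈ᴹ-trans (*ₗ-congʳ (a≈0 i)) (*ₗ-zeroˡ _))

  lc-+ : ∀ n a b e → lc n (λ i → a i + b i) e ≈ᴹ lc n a e +ᴹ lc n b e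
  lc-+ n a b e = ≈ᴹ-trans (∑ᴹ-cong n (λ i → *ₗ-distribʳ (e i) (a i) (b i))) (∑ᴹ-+ n _ _)

  lc-* : ∀ n x a e → lc n (λ i → x * a i) e ≈ᴹ x *ₗ lc n a e
  lc-* n x a e = ≈ᴹ-trans (∑ᴹ-cong n (λ i → *ₗ-assoc x (a i) (e i))) (∑ᴹ-*ₗ n x _)

module DirectSums {c ℓ m ℓm : Level} (F : CommutativeRing c ℓ) (V : Module F m ℓm) where
  open CommutativeRing F hiding (zero)
  open Module V
  open LinAlg F V
  open Sums F V
  open Subspace using (_∈S)

  direct-pair : ∀ {n} (W : Fin n → Subspace) → IsDirectSum W → ∀ {k₁ k₂} → k₁ ≢ k₂ →
                ∀ {x₁ x₂} → (W k₁ ∈S) x₁ → (W k₂ ∈S) x₂ → x₁ +ᴹ x₂ ≈ᴹ 0ᴹ → x₁ ≈ᴹ 0ᴹ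
  direct-pair {n} W direct {k₁} {k₂} k₁≢k₂ {x₁} {x₂} x₁∈ x₂∈ x₁+x₂≈0 = begin
    x₁                    ≈⟨ ≈ᴹ-sym (+ᴹ-identityʳ x₁) ⟩
    x₁ +ᴹ 0ᴹ              ≈⟨ +ᴹ-cong (≈ᴹ-sym (diag k₁ x₁)) (≈ᴹ-sym (off k₂ k₁ (k₁≢k₂ ∘ P.sym) x₂)) ⟩
    family k₁             ≈⟨ direct family family∈ family-sum k₁ ⟩
    0ᴹ                    ∎
    where
    open SetoidReasoning ≈ᴹ-setoid
    diag : ∀ k x → I k k *ₗ x ≈ᴹ x
    diag k x = ≈ᴹ-trans (*ₗ-congʳ (δ-diag k)) (*ₗ-identityˡ x)
    off : ∀ k k′ → k ≢ k′ → ∀ x → I k k′ *ₗ x ≈ᴹ 0ᴹ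
    off k k′ k≢k′ x = ≈ᴹ-trans (*ₗ-congʳ (δ-off k k′ k≢k′)) (*ₗ-zeroˡ x)
    family : Fin n → Carrierᴹ
    family k = I k₁ k *ₗ x₁ +ᴹ I k₂ k *ₗ x₂
    in-slot : ∀ k′ k x → (W k′ ∈S) x → (W k ∈S) (I k′ k *ₗ x)
    in-slot k′ k x x∈ with k′ Fin.≟ k
    ... | yes P.refl = Subspace.∈-resp (W k′) (≈ᴹ-sym (*ₗ-identityˡ x)) x∈
    ... | no _       = Subspace.∈-resp (W k) (≈ᴹ-sym (*ₗ-zeroˡ x)) (Subspace.0∈ (W k))
    family∈ : ∀ k → (W k ∈S) (family k)
    family∈ k = Subspace.+∈ (W k) (in-slot k₁ k x₁ x₁∈) (in-slot k₂ k x₂ x₂∈)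
    family-sum : ∑ᴹ n family ≈ᴹ 0ᴹ
    family-sum = ≈ᴹ-trans (∑ᴹ-+ n _ _)
      (≈ᴹ-trans (+ᴹ-cong (∑ᴹ-δ n k₁ (λ _ → x₁)) (∑ᴹ-δ n k₂ (λ _ → x₂))) x₁+x₂≈0)

module Coordinates {c ℓ m ℓm : Level} (F : CommutativeRing c ℓ) (V : Module F m ℓm)
                   {N : ℕ} (u : Fin N → Module.Carrierᴹ V) (u-basis : LinAlg.IsBasis F V u) where
  open CommutativeRing F hiding (zero)
  open Module V
  open LinAlg F V
  open Sums F V
  private
    module +ᴹ-Group = GroupProps +ᴹ-group
    module +-Group = GroupProps +-group

  coord : Carrierᴹ → Fin N → Carrier
  coord x = proj₁ (proj₂ u-basis x)

  expansion : ∀ x → x ≈ᴹ lc N (coord x) u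
  expansion x = proj₂ (proj₂ u-basis x)

  lc-injective : ∀ {a b} → lc N a u ≈ᴹ lc N b u → ∀ i → a i ≈ b i
  lc-injective {a} {b} a≈b i = +-Group.x∙y⁻¹≈ε⇒x≈y (a i) (b i) (proj₁ u-basis (λ i → a i - b i) difference i)
    where
    difference : lc N (λ i → a i - b i) u ≈ᴹ 0ᴹ
    difference = +ᴹ-Group.identityˡ-unique _ (lc N b u) (begin
      lc N (λ i → a i - b i) u +ᴹ lc N b u ≈⟨ ≈ᴹ-sym (lc-+ N _ b u) ⟩
      lc N (λ i → a i - b i + b i) u      ≈⟨ lc-cong N u (λ i → +-Group.//-rightDividesˡ (b i) (a i)) ⟩
      lc N a u                             ≈⟨ a≈b ⟩
      lc N b u                             ∎)
      where open SetoidReasoning ≈ᴹ-setoid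

  coord-unique : ∀ {x a} → x ≈ᴹ lc N a u → ∀ i → coord x i ≈ a i
  coord-unique {x} x≈a = lc-injective (≈ᴹ-trans (≈ᴹ-sym (expansion x)) x≈a)

  coord-cong : ∀ {x y} → x ≈ᴹ y → ∀ i → coord x i ≈ coord y i
  coord-cong {x} {y} x≈y = coord-unique (≈ᴹ-trans x≈y (expansion y))

  coord-+ : ∀ x y i → coord (x +ᴹ y) i ≈ coord x i + coord y i
  coord-+ x y = coord-unique (≈ᴹ-trans (+ᴹ-cong (expansion x) (expansion y)) (≈ᴹ-sym (lc-+ N _ _ u)))

  coord-*ₗ : ∀ a x i → coord (a *ₗ x) i ≈ a * coord x i
  coord-*ₗ a x = coord-unique (≈ᴹ-trans (*ₗ-congˡ (expansion x)) (≈ᴹ-sym (lc-* N a _ u)))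

  coord-0 : ∀ i → coord 0ᴹ i ≈ 0#
  coord-0 = coord-unique {a = λ _ → 0#} (≈ᴹ-sym (lc-zero N u (λ _ → refl)))

  coord-∑ᴹ : ∀ n (f : Fin n → Carrierᴹ) i → coord (∑ᴹ n f) i ≈ ∑ n (λ k → coord (f k) i)
  coord-∑ᴹ zero    f i = coord-0 i
  coord-∑ᴹ (suc n) f i = trans (coord-+ _ _ i) (+-congˡ (coord-∑ᴹ n (λ k → f (suc k)) i))

  coord-basis : ∀ p i → coord (u p) i ≈ I p i
  coord-basis p = coord-unique (≈ᴹ-sym (∑ᴹ-δ N p u))

  coord-zero⇒zero : ∀ {x} → (∀ i → coord x i ≈ 0#) → x ≈ᴹ 0ᴹ
  coord-zero⇒zero {x} x≈0 = ≈ᴹ-trans (expansion x) (lc-zero N u x≈0)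

-- Linear algebra over a field: Gaussian elimination decides whether the
-- rows of a k × N matrix are linearly dependent, and bounds k by N when
-- they are not.  (The module V is only needed because the sums and
-- matrices of Defs live in 'LinAlg F V'.)
module FieldLinAlg {c ℓ m ℓm : Level} (F : CommutativeRing c ℓ) (isField : IsField F)
                   (V : Module F m ℓm) where
  open CommutativeRing F hiding (zero)
  open Module V
  open LinAlg F V
  open Sums F V
  open IsField isField
  open RingProps ring using (+-cancelˡ; +-cancelʳ; +-inverseˡ-unique; -‿distribˡ-*; -‿distribʳ-*)
  open CommSemigroupProps *-commutativeSemigroup using (x∙yz≈y∙xz)
  private module +-Group = GroupProps +-group

  nonzero⇒invertible : ∀ {x} → ¬ x ≈ 0# → ∃ λ y → x * y ≈ 1#
  nonzero⇒invertible {x} x≉0 with zeroOrInvertible x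
  ... | inj₁ x≈0  = ⊥-elim (x≉0 x≈0)
  ... | inj₂ x⁻¹  = x⁻¹

  cancel-invertible : ∀ {w y x z} → w * y ≈ 1# → x * w ≈ z * w → x ≈ z
  cancel-invertible {w} {y} {x} {z} wy≈1 xw≈zw = begin
    x             ≈⟨ sym (*-identityʳ x) ⟩
    x * 1#        ≈⟨ *-congˡ (sym wy≈1) ⟩
    x * (w * y)   ≈⟨ sym (*-assoc x w y) ⟩
    (x * w) * y   ≈⟨ *-congʳ xw≈zw ⟩
    (z * w) * y   ≈⟨ *-assoc z w y ⟩
    z * (w * y)   ≈⟨ *-congˡ wy≈1 ⟩
    z * 1#        ≈⟨ *-identityʳ z ⟩
    z             ∎
    where open SetoidReasoning setoid

  nonzero-cancel : ∀ {x z} → ¬ x ≈ 0# → x * z ≈ 0# → z ≈ 0#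
  nonzero-cancel {x} {z} x≉0 xz≈0 =
    cancel-invertible (proj₂ (nonzero⇒invertible x≉0)) (trans (*-comm z x) (trans xz≈0 (sym (zeroˡ x))))

  basis-vector≉0 : ∀ {n} (e : Fin n → Carrierᴹ) → LinIndependent e → ∀ p → ¬ e p ≈ᴹ 0ᴹ
  basis-vector≉0 {n} e indep p ep≈0 = 1≉0 (trans (sym (δ-diag p)) (indep (I p) (≈ᴹ-trans (∑ᴹ-δ n p e) ep≈0) p))

  *ₗ-cancel : ∀ {a x} → ¬ x ≈ᴹ 0ᴹ → a *ₗ x ≈ᴹ 0ᴹ → a ≈ 0#
  *ₗ-cancel {a} {x} x≉0 ax≈0 with zeroOrInvertible a
  ... | inj₁ a≈0 = a≈0
  ... | inj₂ (b , ab≈1) = ⊥-elim (x≉0 (begin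
    x               ≈⟨ ≈ᴹ-sym (*ₗ-identityˡ x) ⟩
    1# *ₗ x         ≈⟨ *ₗ-congʳ (trans (sym ab≈1) (*-comm a b)) ⟩
    (b * a) *ₗ x    ≈⟨ *ₗ-assoc b a x ⟩
    b *ₗ (a *ₗ x)   ≈⟨ *ₗ-congˡ ax≈0 ⟩
    b *ₗ 0ᴹ         ≈⟨ *ₗ-zeroʳ b ⟩
    0ᴹ              ∎))
    where open SetoidReasoning ≈ᴹ-setoid

  IsRelation : ∀ {k N} → (Fin k → Fin N → Carrier) → (Fin k → Carrier) → Set ℓ
  IsRelation {k} w a = ∀ l → ∑ k (λ q → a q * w q l) ≈ 0#

  Dependent : ∀ {k N} → (Fin k → Fin N → Carrier) → Set (c ⊔ ℓ)
  Dependent w = ∃ λ a → IsRelation w a × ∃ λ p → ¬ a p ≈ 0#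

  Independent : ∀ {k N} → (Fin k → Fin N → Carrier) → Set (c ⊔ ℓ)
  Independent w = ∀ a → IsRelation w a → ∀ q → a q ≈ 0#

  find-invertible : ∀ k (f : Fin k → Carrier) → (∀ q → f q ≈ 0#) ⊎ ∃ λ q → ∃ λ y → f q * y ≈ 1#
  find-invertible zero    f = inj₁ (λ ())
  find-invertible (suc k) f with zeroOrInvertible (f zero) | find-invertible k (λ q → f (suc q))
  ... | inj₂ f₀⁻¹ | _                   = inj₂ (zero , f₀⁻¹)
  ... | inj₁ f₀≈0 | inj₁ rest≈0         = inj₁ λ { zero → f₀≈0 ; (suc q) → rest≈0 q }
  ... | inj₁ _    | inj₂ (q , fq⁻¹)     = inj₂ (suc q , fq⁻¹)

  -- Row p has an invertible entry in column 0;
  -- subtracting multiples of it clears column 0 of the other rows, and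
  -- the dependence of the rows of w reduces to that of the remaining
  -- k × N matrix 'reduced'.
  module Pivot {k N} (w : Fin (suc k) → Fin (suc N) → Carrier) (p : Fin (suc k))
               {y : Carrier} (pivot⁻¹ : w p zero * y ≈ 1#) where

    multiplier : Fin k → Carrier
    multiplier q = - (w (punchIn p q) zero * y)

    cleared : Fin k → Fin (suc N) → Carrier
    cleared q l = w (punchIn p q) l + multiplier q * w p l

    reduced : Fin k → Fin N → Carrier
    reduced q l = cleared q (suc l)

    cleared-column₀ : ∀ q → cleared q zero ≈ 0#
    cleared-column₀ q = begin
      x + - (x * y) * w p zero   ≈⟨ +-congˡ (sym (-‿distribˡ-* (x * y) (w p zero))) ⟩
      x + - (x * y * w p zero)   ≈⟨ +-congˡ (-‿cong (*-assoc x y (w p zero))) ⟩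
      x + - (x * (y * w p zero)) ≈⟨ +-congˡ (-‿cong (*-congˡ (trans (*-comm y _) pivot⁻¹))) ⟩
      x + - (x * 1#)             ≈⟨ +-congˡ (-‿cong (*-identityʳ x)) ⟩
      x + - x                    ≈⟨ -‿inverseʳ x ⟩
      0#                         ∎
      where
      open SetoidReasoning setoid
      x : Carrier
      x = w (punchIn p q) zero

    -- the coefficient the pivot row receives when b is lifted to w
    lifted : (Fin k → Carrier) → Carrier
    lifted b = ∑ k (λ q → b q * multiplier q)

    ∑-cleared : ∀ (b : Fin k → Carrier) l →
                ∑ k (λ q → b q * cleared q l) ≈ ∑ k (λ q → b q * w (punchIn p q) l) + lifted b * w p l
    ∑-cleared b l = begin
      ∑ k (λ q → b q * cleared q l)
        ≈⟨ ∑-cong k (λ q → trans (distribˡ (b q) _ _) (+-congˡ (sym (*-assoc (b q) _ _)))) ⟩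
      ∑ k (λ q → b q * w (punchIn p q) l + b q * multiplier q * w p l)
        ≈⟨ ∑-+ k _ _ ⟩
      ∑ k (λ q → b q * w (punchIn p q) l) + ∑ k (λ q → b q * multiplier q * w p l)
        ≈⟨ +-congˡ (∑-*ʳ k (w p l) (λ q → b q * multiplier q)) ⟩
      ∑ k (λ q → b q * w (punchIn p q) l) + lifted b * w p l ∎
      where open SetoidReasoning setoid

    split : ∀ (a : Fin (suc k) → Carrier) (b : Fin k → Carrier) → (∀ q → a (punchIn p q) ≈ b q) → ∀ l →
            ∑ (suc k) (λ x → a x * w x l) + lifted b * w p l ≈ a p * w p l + ∑ k (λ q → b q * cleared q l)
    split a b a≈b l = begin
      ∑ (suc k) (λ x → a x * w x l) + lifted b * w p l
        ≈⟨ +-congʳ (∑-extract k (λ x → a x * w x l) p) ⟩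
      a p * w p l + ∑ k (λ q → a (punchIn p q) * w (punchIn p q) l) + lifted b * w p l
        ≈⟨ +-assoc _ _ _ ⟩
      a p * w p l + (∑ k (λ q → a (punchIn p q) * w (punchIn p q) l) + lifted b * w p l)
        ≈⟨ +-congˡ (+-congʳ (∑-cong k (λ q → *-congʳ (a≈b q)))) ⟩
      a p * w p l + (∑ k (λ q → b q * w (punchIn p q) l) + lifted b * w p l)
        ≈⟨ +-congˡ (sym (∑-cleared b l)) ⟩
      a p * w p l + ∑ k (λ q → b q * cleared q l) ∎
      where open SetoidReasoning setoid

    ∑-cleared-column₀ : ∀ (b : Fin k → Carrier) → ∑ k (λ q → b q * cleared q zero) ≈ 0#
    ∑-cleared-column₀ b = ∑-zero k (λ q → trans (*-congˡ (cleared-column₀ q)) (zeroʳ (b q)))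

    lift-dependent : Dependent reduced → Dependent w
    lift-dependent (b , b-rel , q₀ , bq₀≉0) = a , a-rel , punchIn p q₀ , a≉0
      where
      a : Fin (suc k) → Carrier
      a = insertAt b p (lifted b)
      a-punchIn : ∀ q → a (punchIn p q) ≈ b q
      a-punchIn q = reflexive (insertAt-punchIn b p (lifted b) q)
      a≈cleared : ∀ l → ∑ (suc k) (λ x → a x * w x l) ≈ ∑ k (λ q → b q * cleared q l)
      a≈cleared l = +-cancelʳ (lifted b * w p l) _ _ (trans (split a b a-punchIn l)
        (trans (+-congʳ (*-congʳ (reflexive (insertAt-lookup b p (lifted b))))) (+-comm _ _)))
      a-rel : IsRelation w a
      a-rel zero    = trans (a≈cleared zero) (∑-cleared-column₀ b)
      a-rel (suc l) = trans (a≈cleared (suc l)) (b-rel l)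
      a≉0 : ¬ a (punchIn p q₀) ≈ 0#
      a≉0 aq₀≈0 = bq₀≉0 (trans (sym (a-punchIn q₀)) aq₀≈0)

    lift-independent : Independent reduced → Independent w
    lift-independent reduced-indep a a-rel = a≈0
      where
      b : Fin k → Carrier
      b q = a (punchIn p q)
      split-rel : ∀ l → lifted b * w p l ≈ a p * w p l + ∑ k (λ q → b q * cleared q l)
      split-rel l = trans (sym (trans (+-congʳ (a-rel l)) (+-identityˡ _))) (split a b (λ _ → refl) l)
      lifted≈ap : lifted b ≈ a p
      lifted≈ap = cancel-invertible pivot⁻¹
        (trans (split-rel zero) (trans (+-congˡ (∑-cleared-column₀ b)) (+-identityʳ _)))
      b-rel : IsRelation reduced b
      b-rel l = sym (+-cancelˡ (a p * w p (suc l)) _ _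
        (trans (+-identityʳ _) (trans (*-congʳ (sym lifted≈ap)) (split-rel (suc l)))))
      b≈0 : ∀ q → b q ≈ 0#
      b≈0 = reduced-indep b b-rel
      ap≈0 : a p ≈ 0#
      ap≈0 = trans (sym lifted≈ap) (∑-zero k (λ q → trans (*-congʳ (b≈0 q)) (zeroˡ _)))
      a≈0 : ∀ x → a x ≈ 0#
      a≈0 x with p Fin.≟ x
      ... | yes P.refl = ap≈0
      ... | no p≢x = trans (reflexive (P.cong a (P.sym (punchIn-punchOut p≢x)))) (b≈0 (punchOut p≢x))

  dependent-or-independent : ∀ k N (w : Fin k → Fin N → Carrier) → Dependent w ⊎ (Independent w × k ℕ.≤ N)
  dependent-or-independent zero    N       w = inj₂ ((λ _ _ ()) , ℕ.z≤n)
  dependent-or-independent (suc k) zero    w = inj₁ ((λ _ → 1#) , (λ ()) , zero , 1≉0)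
  dependent-or-independent (suc k) (suc N) w with find-invertible (suc k) (λ q → w q zero)
  ... | inj₁ column₀≈0 with dependent-or-independent (suc k) N (λ q l → w q (suc l))
  ...   | inj₁ (a , a-rel , dep) = inj₁ (a , a-rel′ , dep)
    where
    a-rel′ : IsRelation w a
    a-rel′ zero    = ∑-zero (suc k) (λ q → trans (*-congˡ (column₀≈0 q)) (zeroʳ (a q)))
    a-rel′ (suc l) = a-rel l
  ...   | inj₂ (indep , k<N) = inj₂ ((λ a a-rel → indep a (λ l → a-rel (suc l))) , NatProps.m≤n⇒m≤1+n k<N)
  dependent-or-independent (suc k) (suc N) w | inj₂ (p , y , pivot⁻¹)
    with dependent-or-independent k N (Pivot.reduced w p pivot⁻¹)
  ... | inj₁ dep = inj₁ (Pivot.lift-dependent w p pivot⁻¹ dep)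
  ... | inj₂ (indep , k≤N) = inj₂ (Pivot.lift-independent w p pivot⁻¹ indep , ℕ.s≤s k≤N)

  too-many-rows : ∀ N (w : Fin (suc N) → Fin N → Carrier) → Dependent w
  too-many-rows N w with dependent-or-independent (suc N) N w
  ... | inj₁ dep           = dep
  ... | inj₂ (_ , sN≤N)    = ⊥-elim (NatProps.<-irrefl P.refl sN≤N)

  -- A square matrix with a right inverse has trivial kernel: if A z = 0,
  -- a dependence between z and the columns of B, multiplied by A, gives
  -- a dependence between A z = 0 and the unit vectors, forcing z = 0.
  right-inverse⇒injective : ∀ N (A B : Matrix N) → (A · B) ≈M I → (z : Fin N → Carrier) →
                            (∀ l → ∑ N (λ k → A l k * z k) ≈ 0#) → ∀ k → z k ≈ 0#
  right-inverse⇒injective N A B AB≈I z Az≈0 = z≈0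
    where
    rows : Fin (suc N) → Fin N → Carrier
    rows zero      = z
    rows (suc m) k = B k m
    dependence : Dependent rows
    dependence = too-many-rows N rows
    coeff : Fin (suc N) → Carrier
    coeff = proj₁ dependence
    coeff-rel : IsRelation rows coeff
    coeff-rel = proj₁ (proj₂ dependence)
    -- A applied to the relation: coefficient l+1 equals the l-th entry of 0
    A·relation : ∀ l → coeff (suc l) ≈ 0#
    A·relation l = begin
      coeff (suc l)                                                   ≈⟨ sym (∑-δ N l (λ m → coeff (suc m))) ⟩
      ∑ N (λ m → I l m * coeff (suc m))                              ≈⟨ ∑-cong N (λ m → *-congʳ (sym (AB≈I l m))) ⟩
      ∑ N (λ m → (A · B) l m * coeff (suc m))                        ≈⟨ sym (+-identityˡ _) ⟩
      0# + ∑ N (λ m → (A · B) l m * coeff (suc m))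
        ≈⟨ +-cong (sym (trans (*-congˡ (Az≈0 l)) (zeroʳ _))) (∑-cong N (λ m → *-comm _ _)) ⟩
      coeff zero * ∑ N (λ k → A l k * z k) + ∑ N (λ m → coeff (suc m) * (A · B) l m)
        ≈⟨ +-cong (sym (∑-*ˡ N _ _)) (∑-cong N (λ m → sym (∑-*ˡ N _ _))) ⟩
      ∑ (suc N) (λ q → ∑ N (λ k → coeff q * (A l k * rows q k)))
        ≈⟨ ∑-cong (suc N) (λ q → ∑-cong N (λ k → x∙yz≈y∙xz (coeff q) (A l k) (rows q k))) ⟩
      ∑ (suc N) (λ q → ∑ N (λ k → A l k * (coeff q * rows q k)))
        ≈⟨ ∑-swap (suc N) N (λ q k → A l k * (coeff q * rows q k)) ⟩
      ∑ N (λ k → ∑ (suc N) (λ q → A l k * (coeff q * rows q k)))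
        ≈⟨ ∑-cong N (λ k → ∑-*ˡ (suc N) (A l k) (λ q → coeff q * rows q k)) ⟩
      ∑ N (λ k → A l k * ∑ (suc N) (λ q → coeff q * rows q k))
        ≈⟨ ∑-zero N (λ k → trans (*-congˡ (coeff-rel k)) (zeroʳ _)) ⟩
      0#                                                              ∎
      where open SetoidReasoning setoid
    coeff₀≉0 : ¬ coeff zero ≈ 0#
    coeff₀≉0 with proj₂ (proj₂ dependence)
    ... | zero  , c₀≉0 = c₀≉0
    ... | suc l , cl≉0 = ⊥-elim (cl≉0 (A·relation l))
    z≈0 : ∀ k → z k ≈ 0#
    z≈0 k = nonzero-cancel coeff₀≉0
      (trans (sym (+-identityʳ _))
        (trans (+-congˡ (sym (∑-zero N (λ m → trans (*-congʳ (A·relation m)) (zeroˡ _))))) (coeff-rel k)))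

  right-inverse⇒invertible : ∀ N (A B : Matrix N) → (A · B) ≈M I → Invertible A
  right-inverse⇒invertible N A B AB≈I = B , AB≈I , BA≈I
    where
    BA≈I : (B · A) ≈M I
    BA≈I k a = +-Group.x∙y⁻¹≈ε⇒x≈y _ _
      (right-inverse⇒injective N A B AB≈I (λ k → (B · A) k a - I k a) A·difference k)
      where
      A·difference : ∀ l → ∑ N (λ k → A l k * ((B · A) k a - I k a)) ≈ 0#
      A·difference l = begin
        ∑ N (λ k → A l k * ((B · A) k a - I k a))
          ≈⟨ ∑-cong N (λ k → trans (distribˡ _ _ _) (+-congˡ (sym (-‿distribʳ-* _ _)))) ⟩
        ∑ N (λ k → A l k * (B · A) k a - A l k * I k a) ≈⟨ ∑-minus N _ _ ⟩
        (A · (B · A)) l a - (A · I) l a           ≈⟨ +-cong (sym (·-assoc A B A l a)) (-‿cong (·I-identity A l a)) ⟩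
        ((A · B) · A) l a - A l a                 ≈⟨ +-congʳ (∑-cong N (λ m → *-congʳ (AB≈I l m))) ⟩
        (I · A) l a - A l a                       ≈⟨ +-congʳ (I·-identity A l a) ⟩
        A l a - A l a                             ≈⟨ -‿inverseʳ _ ⟩
        0#                                        ∎
        where open SetoidReasoning setoid

  solve-for : ∀ {k N} (w : Fin (suc k) → Fin N → Carrier) {a} → IsRelation w a → ∀ p → ¬ a p ≈ 0# →
              ∃ λ b → ∀ l → w p l ≈ ∑ k (λ q → b q * w (punchIn p q) l)
  solve-for {k} {N} w {a} a-rel p ap≉0 = b , w-p
    where
    y : Carrier
    y = proj₁ (nonzero⇒invertible ap≉0)
    b : Fin k → Carrier
    b q = - (y * a (punchIn p q))
    rest : Fin N → Carrier
    rest l = ∑ k (λ q → a (punchIn p q) * w (punchIn p q) l)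
    w-p : ∀ l → w p l ≈ ∑ k (λ q → b q * w (punchIn p q) l)
    w-p l = begin
      w p l                         ≈⟨ sym (*-identityˡ _) ⟩
      1# * w p l                    ≈⟨ *-congʳ (trans (sym (proj₂ (nonzero⇒invertible ap≉0))) (*-comm _ _)) ⟩
      y * a p * w p l               ≈⟨ *-assoc y _ _ ⟩
      y * (a p * w p l)
        ≈⟨ *-congˡ (+-inverseˡ-unique _ _ (trans (sym (∑-extract k (λ x → a x * w x l) p)) (a-rel l))) ⟩
      y * - rest l                  ≈⟨ sym (-‿distribʳ-* y _) ⟩
      - (y * rest l)                ≈⟨ -‿cong (sym (∑-*ˡ k y _)) ⟩
      - ∑ k (λ q → y * (a (punchIn p q) * w (punchIn p q) l)) ≈⟨ sym (∑-neg k _) ⟩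
      ∑ k (λ q → - (y * (a (punchIn p q) * w (punchIn p q) l)))
        ≈⟨ ∑-cong k (λ q → trans (-‿cong (sym (*-assoc _ _ _))) (-‿distribˡ-* _ _)) ⟩
      ∑ k (λ q → b q * w (punchIn p q) l) ∎
      where open SetoidReasoning setoid

  relation-closure : ∀ {k N p′} {P : (Fin N → Carrier) → Set p′} → LinearlyClosed P →
                     (w : Fin (suc k) → Fin N → Carrier) {a : Fin (suc k) → Carrier} → IsRelation w a →
                     ∀ p → ¬ a p ≈ 0# → (∀ q → P (w (punchIn p q))) → P (w p)
  relation-closure {k} closed w {a} a-rel p ap≉0 others =
    resp (λ l → sym (proj₂ solved l)) (combination k (proj₁ solved) (λ q → w (punchIn p q)) others)
    where
    open LinearlyClosed closed
    solved : ∃ λ b → ∀ l → w p l ≈ ∑ k (λ q → b q * w (punchIn p q) l)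
    solved = solve-for w {a} a-rel p ap≉0

module BilliardArrays {c ℓ m ℓm : Level} (F : CommutativeRing c ℓ) (isField : IsField F)
                      (V : Module F m ℓm) {d : ℕ} (B : Δ d → LinAlg.OneDimSubspace F V)
                      (billiard : LinAlg.IsBilliardArray F V d B)
                      {N : ℕ} (e : Fin N → Module.Carrierᴹ V) (e-basis : LinAlg.IsBasis F V e) where
  open CommutativeRing F hiding (zero)
  open Module V
  open LinAlg F V
  open Sums F V
  open DirectSums F V
  open Coordinates F V e e-basis
  open FieldLinAlg F isField V
  open IsBilliardArray billiard
  open Simplex

  gen : Δ d → Carrierᴹ
  gen pt = OneDimSubspace.gen (B pt)

  profile : Δ d → Fin N → Carrier
  profile pt = coord (gen pt)

  member-scalar : ∀ pt {x} → x ∈₁ B pt → ∃ λ κ → x ≈ᴹ κ *ₗ gen pt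
  member-scalar pt {x} x∈ = Equivalence.to (OneDimSubspace.spanned (B pt) x) x∈

  scaled∈ : ∀ pt κ → (κ *ₗ gen pt) ∈₁ B pt
  scaled∈ pt κ = Equivalence.from (OneDimSubspace.spanned (B pt) (κ *ₗ gen pt)) (κ , ≈ᴹ-refl)

  member-coord : ∀ pt {x} → x ∈₁ B pt → ∃ λ κ → ∀ l → coord x l ≈ κ * profile pt l
  member-coord pt {x} x∈ with member-scalar pt x∈
  ... | κ , x≈κg = κ , λ l → trans (coord-cong x≈κg l) (coord-*ₗ κ (gen pt) l)

  profile-from-member : ∀ pt {x} → x ∈₁ B pt → ¬ x ≈ᴹ 0ᴹ → ∃ λ κ → ∀ l → profile pt l ≈ κ * coord x l
  profile-from-member pt {x} x∈ x≉0 with member-scalar pt x∈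
  ... | κ , x≈κg = κ⁻¹ , λ l → begin
      profile pt l               ≈⟨ sym (*-identityˡ _) ⟩
      1# * profile pt l          ≈⟨ *-congʳ (trans (sym κκ⁻¹≈1) (*-comm κ κ⁻¹)) ⟩
      κ⁻¹ * κ * profile pt l     ≈⟨ *-assoc κ⁻¹ κ _ ⟩
      κ⁻¹ * (κ * profile pt l)   ≈⟨ *-congˡ (sym (trans (coord-cong x≈κg l) (coord-*ₗ κ (gen pt) l))) ⟩
      κ⁻¹ * coord x l            ∎
    where
    open SetoidReasoning setoid
    κ≉0 : ¬ κ ≈ 0#
    κ≉0 κ≈0 = x≉0 (≈ᴹ-trans x≈κg (≈ᴹ-trans (*ₗ-congʳ κ≈0) (*ₗ-zeroˡ _)))
    κ⁻¹ : Carrier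
    κ⁻¹ = proj₁ (nonzero⇒invertible κ≉0)
    κκ⁻¹≈1 : κ * κ⁻¹ ≈ 1#
    κκ⁻¹≈1 = proj₂ (nonzero⇒invertible κ≉0)

  direct-from-independent : ∀ {n} (pts : Fin n → Δ d) → Independent (λ q → profile (pts q)) →
                            IsDirectSum (λ q → OneDimSubspace.subspace (B (pts q)))
  direct-from-independent {n} pts indep w w∈ ∑w≈0 q =
    ≈ᴹ-trans (proj₂ (scalar q)) (≈ᴹ-trans (*ₗ-congʳ (indep (λ q → proj₁ (scalar q)) relation q)) (*ₗ-zeroˡ _))
    where
    open SetoidReasoning setoid
    scalar : ∀ q → ∃ λ κ → w q ≈ᴹ κ *ₗ gen (pts q)
    scalar q = member-scalar (pts q) (w∈ q)
    relation : IsRelation (λ q → profile (pts q)) (λ q → proj₁ (scalar q))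
    relation l = begin
      ∑ n (λ q → proj₁ (scalar q) * profile (pts q) l)
        ≈⟨ ∑-cong n (λ q → sym (trans (coord-cong (proj₂ (scalar q)) l) (coord-*ₗ _ _ l))) ⟩
      ∑ n (λ q → coord (w q) l)                       ≈⟨ sym (coord-∑ᴹ n w l) ⟩
      coord (∑ᴹ n w) l                                ≈⟨ coord-cong ∑w≈0 l ⟩
      coord 0ᴹ l                                      ≈⟨ coord-0 l ⟩
      0#                                              ∎

  -- Two distinct points of a line have independent generators, because
  -- the sum over a line is direct.
  line-pair : ∀ η x (x≤d : x ℕ.≤ d) {k₁ k₂} → k₁ ≢ k₂ → ∀ {p₁ p₂} →
              line η x x≤d k₁ ≡ p₁ → line η x x≤d k₂ ≡ p₂ → ∀ {α β} →
              (∀ l → α * profile p₁ l + β * profile p₂ l ≈ 0#) → α ≈ 0# × β ≈ 0#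
  line-pair η x x≤d {k₁} {k₂} k₁≢k₂ {p₁} {p₂} P.refl P.refl {α} {β} combination≈0 =
    *ₗ-cancel (gen≉0 p₁) (vanishes k₁≢k₂ (scaled∈ p₁ α) (scaled∈ p₂ β) sum≈0) ,
    *ₗ-cancel (gen≉0 p₂)
      (vanishes (k₁≢k₂ ∘ P.sym) (scaled∈ p₂ β) (scaled∈ p₁ α) (≈ᴹ-trans (+ᴹ-comm _ _) sum≈0))
    where
    gen≉0 : ∀ pt → ¬ gen pt ≈ᴹ 0ᴹ
    gen≉0 pt = OneDimSubspace.gen≉0 (B pt)
    vanishes : ∀ {k k′} → k ≢ k′ → ∀ {x₁ x₂} → x₁ ∈₁ B (line η x x≤d k) → x₂ ∈₁ B (line η x x≤d k′) →
               x₁ +ᴹ x₂ ≈ᴹ 0ᴹ → x₁ ≈ᴹ 0ᴹ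
    vanishes = direct-pair (λ k → OneDimSubspace.subspace (B (line η x x≤d k))) (lines-direct η x x≤d)
    sum≈0 : α *ₗ gen p₁ +ᴹ β *ₗ gen p₂ ≈ᴹ 0ᴹ
    sum≈0 = coord-zero⇒zero λ l →
      trans (coord-+ _ _ l) (trans (+-cong (coord-*ₗ α _ l) (coord-*ₗ β _ l)) (combination≈0 l))

  same-r : ∀ (p q : Δ d) → Δ.r p ≡ Δ.r q → Δ.s p ≢ Δ.s q → ∀ {α β} →
           (∀ l → α * profile p l + β * profile q l ≈ 0#) → α ≈ 0# × β ≈ 0#
  same-r p@(⟨ r , _ , _ ∣ _ ⟩) q@(⟨ _ , _ , _ ∣ _ ⟩) P.refl s≢ =
    line-pair η₁ r (r≤d p) (slots-differ p q s≢ ∘ P.cong toℕ) (on-line₁ p (r≤d p)) (on-line₁ q (r≤d p))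

  same-s : ∀ (p q : Δ d) → Δ.s p ≡ Δ.s q → Δ.t p ≢ Δ.t q → ∀ {α β} →
           (∀ l → α * profile p l + β * profile q l ≈ 0#) → α ≈ 0# × β ≈ 0#
  same-s p@(⟨ _ , s , _ ∣ _ ⟩) q@(⟨ _ , _ , _ ∣ _ ⟩) P.refl t≢ =
    line-pair η₂ s (r≤d (rotate p)) (slots-differ (rotate p) (rotate q) t≢ ∘ P.cong toℕ)
      (on-line₂ p (r≤d (rotate p))) (on-line₂ q (r≤d (rotate p)))

  same-t : ∀ (p q : Δ d) → Δ.t p ≡ Δ.t q → Δ.r p ≢ Δ.r q → ∀ {α β} →
           (∀ l → α * profile p l + β * profile q l ≈ 0#) → α ≈ 0# × β ≈ 0#
  same-t p@(⟨ _ , _ , t ∣ _ ⟩) q@(⟨ _ , _ , _ ∣ _ ⟩) P.refl r≢ =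
    line-pair η₃ t (r≤d (rotate (rotate p))) (slots-differ (rotate (rotate p)) (rotate (rotate q)) r≢ ∘ P.cong toℕ)
      (on-line₃ p (r≤d (rotate (rotate p)))) (on-line₃ q (r≤d (rotate (rotate p))))

  -- Any two points of a black 3-clique lie on a common line; listed as
  -- the two points other than the x-th one.
  clique-pair : ∀ a b t (e : suc (a ℕ.+ b ℕ.+ t) ≡ d) x → ∀ {α β} →
                (∀ l → α * profile (clique a b t e (punchIn x zero)) l
                     + β * profile (clique a b t e (punchIn x (suc zero))) l ≈ 0#) → α ≈ 0# × β ≈ 0#
  clique-pair a b t e zero                = same-r _ _ P.refl (λ ())
  clique-pair a b t e (suc zero)          = same-s _ _ P.refl (λ ())
  clique-pair a b t e (suc (suc zero))    = same-t _ _ P.refl (λ ())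

  -- Since the sum over a black 3-clique is not direct, its generators
  -- satisfy a linear relation; by 'clique-pair' none of its three
  -- coefficients can vanish.
  clique-relation : ∀ a b t (e : suc (a ℕ.+ b ℕ.+ t) ≡ d) →
                    ∃ λ κ → IsRelation (λ q → profile (clique a b t e q)) κ × (∀ q → ¬ κ q ≈ 0#)
  clique-relation a b t e with dependent-or-independent 3 N (λ q → profile (clique a b t e q))
  ... | inj₂ (indep , _) = ⊥-elim (cliques-not-direct a b t e (direct-from-independent (clique a b t e) indep))
  ... | inj₁ (κ , κ-rel , q₀ , κq₀≉0) = κ , κ-rel , nonzero
    where
    point : Fin 3 → Fin N → Carrier
    point q = profile (clique a b t e q)
    nonzero : ∀ x → ¬ κ x ≈ 0#
    nonzero x κx≈0 = κq₀≉0 (all-zero q₀)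
      where
      others : ∀ l → κ (punchIn x zero) * point (punchIn x zero) l
                   + κ (punchIn x (suc zero)) * point (punchIn x (suc zero)) l ≈ 0#
      others l = begin
        _ + _                                       ≈⟨ +-congˡ (sym (+-identityʳ _)) ⟩
        ∑ 2 (λ q → κ (punchIn x q) * point (punchIn x q) l) ≈⟨ sym (+-identityˡ _) ⟩
        0# + ∑ 2 (λ q → κ (punchIn x q) * point (punchIn x q) l)
          ≈⟨ +-congʳ (sym (trans (*-congʳ κx≈0) (zeroˡ _))) ⟩
        κ x * point x l + ∑ 2 (λ q → κ (punchIn x q) * point (punchIn x q) l)
          ≈⟨ sym (∑-extract 2 (λ q → κ q * point q l) x) ⟩
        ∑ 3 (λ q → κ q * point q l)                 ≈⟨ κ-rel l ⟩
        0#                                          ∎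
        where open SetoidReasoning setoid
      pair-zero : ∀ q → κ (punchIn x q) ≈ 0#
      pair-zero zero       = proj₁ (clique-pair a b t e x others)
      pair-zero (suc zero) = proj₂ (clique-pair a b t e x others)
      all-zero : ∀ q → κ q ≈ 0#
      all-zero q with x Fin.≟ q
      ... | yes P.refl = κx≈0
      ... | no x≢q     = trans (reflexive (P.cong κ (P.sym (punchIn-punchOut x≢q)))) (pair-zero (punchOut x≢q))

  clique-closure : ∀ {p′} {P : (Fin N → Carrier) → Set p′} → LinearlyClosed P →
                   ∀ a b t (e : suc (a ℕ.+ b ℕ.+ t) ≡ d) x →
                   (∀ q → P (profile (clique a b t e (punchIn x q)))) → P (profile (clique a b t e x))
  clique-closure closed a b t e x with clique-relation a b t e
  ... | κ , κ-rel , κ≉0 = relation-closure closed (λ q → profile (clique a b t e q)) {κ} κ-rel x (κ≉0 x)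

module TransitionMatrix {c ℓ m ℓm : Level} (F : CommutativeRing c ℓ) (isField : IsField F)
         (V : Module F m ℓm) {d : ℕ} (B : Δ d → LinAlg.OneDimSubspace F V)
         (billiard : LinAlg.IsBilliardArray F V d B)
         (u v : Fin (suc d) → Module.Carrierᴹ V) (u-basis : LinAlg.IsBasis F V u) (v-basis : LinAlg.IsBasis F V v)
         (u∈ : ∀ i → LinAlg._∈₁_ F V (u i) (B (pt-rs i))) (v∈ : ∀ i → LinAlg._∈₁_ F V (v i) (B (pt-rt i)))
         (T : LinAlg.Matrix F V (suc d))
         (v≈Tu : ∀ j → Module._≈ᴹ_ V (v j) (LinAlg.∑ᴹ F V (suc d) (λ i → Module._*ₗ_ V (T i j) (u i)))) where
  open CommutativeRing F hiding (zero)
  open Module V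
  open LinAlg F V
  open Sums F V
  open Coordinates F V u u-basis
  open FieldLinAlg F isField V
  open BilliardArrays F isField V B billiard u u-basis
  open Simplex

  coord-v : ∀ j l → coord (v j) l ≈ T l j
  coord-v j = coord-unique (v≈Tu j)

  -- Let X = span{v_i,…,v_j} and
  -- W = span{u_{n+1},…,u_d}.  A vector lies in X + W iff its first n+1
  -- u-coordinates agree with those of a vector of X, i.e. with a
  -- combination of the columns i,…,j of T.
  module Block (i j : Fin (suc d)) (i≤j : toℕ i ℕ.≤ toℕ j) where
    I₀ J₀ n : ℕ
    I₀ = toℕ i
    J₀ = toℕ j
    n  = J₀ ∸ I₀

    n+I₀≡J₀ : n ℕ.+ I₀ ≡ J₀
    n+I₀≡J₀ = NatProps.m∸n+n≡m i≤j

    J₀≤d : J₀ ℕ.≤ d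
    J₀≤d = NatProps.≤-pred (toℕ<n j)

    -- Row k and column i + k of T are row k and column k of T[i,j].
    lift : Fin (suc n) → Fin (suc d)
    lift k = Fin.fromℕ< (ℕ.s≤s (NatProps.≤-trans (NatProps.≤-pred (toℕ<n k))
                                  (NatProps.≤-trans (NatProps.m∸n≤m J₀ I₀) J₀≤d)))

    shift : Fin (suc n) → Fin (suc d)
    shift k = Fin.fromℕ< (ℕ.s≤s (NatProps.≤-trans (NatProps.+-monoʳ-≤ I₀ (NatProps.≤-pred (toℕ<n k)))
                                   (NatProps.≤-trans I₀+n≤J₀ J₀≤d)))
      where
      I₀+n≤J₀ : I₀ ℕ.+ n ℕ.≤ J₀
      I₀+n≤J₀ = NatProps.≤-reflexive (P.trans (NatProps.+-comm I₀ n) n+I₀≡J₀)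

    -- the u-coordinate vector y belongs to a vector of X + W
    InX+W : (Fin (suc d) → Carrier) → Set (c ⊔ ℓ)
    InX+W y = ∃ λ (α : Fin (suc n) → Carrier) →
              ∀ l → toℕ l ℕ.≤ n → y l ≈ ∑ (suc n) (λ k → α k * T l (shift k))

    X+W-closed : LinearlyClosed InX+W
    X+W-closed = record
      { resp        = λ y≈y′ (α , y≈α) → α , λ l l≤n → trans (sym (y≈y′ l)) (y≈α l l≤n)
      ; combination = λ m b y y∈ → (λ k → ∑ m (λ q → b q * proj₁ (y∈ q) k)) , λ l l≤n →
          trans (∑-cong m (λ q → *-congˡ (proj₂ (y∈ q) l l≤n)))
                (∑-combination m (suc n) b (λ q → proj₁ (y∈ q)) (λ k → T l (shift k)))
      }

    -- X ⊆ X + W: the columns i,…,j of T.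
    column∈ : ∀ k → InX+W (λ l → T l (shift k))
    column∈ k = I k , λ l _ → sym (∑-δ (suc n) k (λ k′ → T l (shift k′)))

    -- W ⊆ X + W: vectors whose first n+1 coordinates vanish.
    vanishing∈ : ∀ {y : Fin (suc d) → Carrier} → (∀ l → toℕ l ℕ.≤ n → y l ≈ 0#) → InX+W y
    vanishing∈ y≈0 = (λ (_ : Fin (suc n)) → 0#) , λ l l≤n →
      trans (y≈0 l l≤n) (sym (∑-zero (suc n) (λ k → zeroˡ (T l (shift k)))))

    -- identifies a point of Δ_d given with two different proofs of r + s + t = d
    transport : ∀ {p q : Δ d} → p ≡ q → InX+W (profile p) → InX+W (profile q)
    transport eq = P.subst (InX+W ∘ profile) eq

    via-clique : ∀ a b t (e : suc (a ℕ.+ b ℕ.+ t) ≡ d) x →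
                 (∀ q → InX+W (profile (clique a b t e (punchIn x q)))) → InX+W (profile (clique a b t e x))
    via-clique = clique-closure X+W-closed

    -- Points with s > n: on the boundary t = 0 these carry u_s ∈ W; the
    -- remaining ones follow by induction on t, each (r,s,t+1) closing
    -- the clique with (r+1,s,t) and (r,s+1,t).
    large-s : ∀ t r s (e : r ℕ.+ s ℕ.+ t ≡ d) → n ℕ.< s → InX+W (profile ⟨ r , s , t ∣ e ⟩)
    large-s zero r s e n<s = transport at-u (vanishing∈ low-coords)
      where
      s≤d : s ℕ.≤ d
      s≤d = r≤d (rotate ⟨ r , s , zero ∣ e ⟩)
      s′ : Fin (suc d)
      s′ = Fin.fromℕ< (ℕ.s≤s s≤d)
      toℕ-s′ : toℕ s′ ≡ s
      toℕ-s′ = toℕ-fromℕ< (ℕ.s≤s s≤d)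
      at-u : pt-rs s′ ≡ ⟨ r , s , zero ∣ e ⟩
      at-u = Δ-≡ (P.trans (P.cong (d ∸_) toℕ-s′) (P.trans (P.cong (_∸ s) (P.sym e′)) (NatProps.m+n∸n≡m r s)))
                 toℕ-s′ P.refl
        where
        e′ : r ℕ.+ s ≡ d
        e′ = P.trans (P.sym (NatProps.+-identityʳ (r ℕ.+ s))) e
      low-coords : ∀ l → toℕ l ℕ.≤ n → profile (pt-rs s′) l ≈ 0#
      member : ∃ λ κ → ∀ l → profile (pt-rs s′) l ≈ κ * coord (u s′) l
      member = profile-from-member (pt-rs s′) (u∈ s′) (basis-vector≉0 u (proj₁ u-basis) s′)
      low-coords l l≤n =
        trans (proj₂ member l) (trans (*-congˡ (trans (coord-basis s′ l) (δ-off s′ l s′≢l))) (zeroʳ _))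
        where
        s′≢l : s′ ≢ l
        s′≢l s′≡l = NatProps.<-irrefl P.refl
          (NatProps.<-≤-trans n<s (NatProps.≤-trans (NatProps.≤-reflexive (P.trans (P.sym toℕ-s′) (P.cong toℕ s′≡l))) l≤n))
    large-s (suc t) r s e n<s = transport (Δ-≡ P.refl P.refl P.refl) (via-clique r s t clique-sum (suc (suc zero)) λ
      { zero       → large-s t (suc r) s _ n<s
      ; (suc zero) → large-s t r (suc s) _ (NatProps.m≤n⇒m≤1+n n<s) })
      where
      clique-sum : suc (r ℕ.+ s ℕ.+ t) ≡ d
      clique-sum = P.trans (P.sym (NatProps.+-suc (r ℕ.+ s) t)) e

    -- Points with I₀ ≤ t and s + t ≤ J₀: on the boundary s = 0 these carry
    -- v_t ∈ X; the remaining ones follow by induction on s, each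
    -- (r,s+1,t) closing the clique with (r+1,s,t) and (r,s,t+1).
    band : ∀ s r t (e : r ℕ.+ s ℕ.+ t ≡ d) → s ℕ.+ t ℕ.≤ J₀ → I₀ ℕ.≤ t → InX+W (profile ⟨ r , s , t ∣ e ⟩)
    band zero r t e t≤J₀ I₀≤t =
      transport at-v (resp (λ l → trans (*-congˡ (sym (coord-v t′ l))) (sym (proj₂ member l)))
                           (scale (proj₁ member) (column∈ k)))
      where
      open LinearlyClosed X+W-closed using (resp; scale)
      k : Fin (suc n)
      k = Fin.fromℕ< (ℕ.s≤s (NatProps.∸-monoˡ-≤ I₀ t≤J₀))
      t′ : Fin (suc d)
      t′ = shift k
      member : ∃ λ κ → ∀ l → profile (pt-rt t′) l ≈ κ * coord (v t′) l
      member = profile-from-member (pt-rt t′) (v∈ t′) (basis-vector≉0 v (proj₁ v-basis) t′)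
      toℕ-t′ : toℕ t′ ≡ t
      toℕ-t′ = P.trans (toℕ-fromℕ< _) (P.trans (P.cong (I₀ ℕ.+_) (toℕ-fromℕ< _)) (NatProps.m+[n∸m]≡n I₀≤t))
      at-v : pt-rt t′ ≡ ⟨ r , zero , t ∣ e ⟩
      at-v = Δ-≡ (P.trans (P.cong (d ∸_) toℕ-t′) (P.trans (P.cong (_∸ t) (P.sym e))
                   (P.trans (NatProps.m+n∸n≡m (r ℕ.+ 0) t) (NatProps.+-identityʳ r))))
                 P.refl toℕ-t′
    band (suc s) r t e s+t≤J₀ I₀≤t = transport (Δ-≡ P.refl P.refl P.refl) (via-clique r s t clique-sum (suc zero) λ
      { zero       → band s (suc r) t _ (NatProps.≤-trans (NatProps.n≤1+n _) s+t≤J₀) I₀≤t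
      ; (suc zero) → band s r (suc t) _ (P.subst (ℕ._≤ J₀) (P.sym (NatProps.+-suc s t)) s+t≤J₀)
                                          (NatProps.m≤n⇒m≤1+n I₀≤t) })
      where
      clique-sum : suc (r ℕ.+ s ℕ.+ t) ≡ d
      clique-sum = P.trans (P.cong (ℕ._+ t) (P.sym (NatProps.+-suc r s))) e

    -- Every point with t ≤ I₀ lies in X + W: it either has s > n, or lies
    -- in the band, or (t < I₀, s ≤ n) closes the clique below it with
    -- (r-1,s+1,t) and (r-1,s,t+1), by induction on r; r = 0 is impossible
    -- there since then s + t < J₀ ≤ d.
    small-t    : ∀ r s t (e : r ℕ.+ s ℕ.+ t ≡ d) → t ℕ.≤ I₀ → InX+W (profile ⟨ r , s , t ∣ e ⟩)
    below-band : ∀ r s t (e : r ℕ.+ s ℕ.+ t ≡ d) → t ℕ.< I₀ → s ℕ.≤ n → InX+W (profile ⟨ r , s , t ∣ e ⟩)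
    small-t r s t e t≤I₀ with n NatProps.<? s | I₀ NatProps.≤? t
    ... | yes n<s | _       = large-s t r s e n<s
    ... | no n≮s  | yes I₀≤t =
      band s r t e (P.subst (s ℕ.+ t ℕ.≤_) n+I₀≡J₀ (NatProps.+-mono-≤ (NatProps.≮⇒≥ n≮s) t≤I₀)) I₀≤t
    ... | no n≮s  | no I₀≰t  = below-band r s t e (NatProps.≰⇒> I₀≰t) (NatProps.≮⇒≥ n≮s)

    below-band zero s t e t<I₀ s≤n = ⊥-elim (NatProps.<-irrefl e s+t<d)
      where
      s+t<d : s ℕ.+ t ℕ.< d
      s+t<d = NatProps.<-≤-trans (NatProps.≤-<-trans (NatProps.+-monoˡ-≤ t s≤n) (NatProps.+-monoʳ-< n t<I₀))
                                 (P.subst (ℕ._≤ d) (P.sym n+I₀≡J₀) J₀≤d)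
    below-band (suc r) s t e t<I₀ s≤n = via-clique r s t e zero λ
      { zero       → small-t r (suc s) t _ (NatProps.<⇒≤ t<I₀)
      ; (suc zero) → small-t r s (suc t) _ t<I₀ }

    -- In particular u_a ∈ X + W for a ≤ n, i.e. the first n+1 coordinates
    -- of u_a are a combination of the columns i,…,j of T.
    u∈X+W : ∀ a → InX+W (coord (u (lift a)))
    u∈X+W a = resp (λ l → sym (proj₂ member l)) (scale (proj₁ member) on-boundary)
      where
      open LinearlyClosed X+W-closed using (resp; scale)
      pt : Δ d
      pt = pt-rs (lift a)
      on-boundary : InX+W (profile pt)
      on-boundary = small-t (Δ.r pt) (Δ.s pt) zero (Δ.sum pt) ℕ.z≤n
      member : ∃ λ κ → ∀ l → coord (u (lift a)) l ≈ κ * profile pt l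
      member = member-coord pt (u∈ (lift a))

    -- Reading these combinations at the rows 0,…,n gives a right inverse
    -- of the block T[i,j].
    right-inverse : Matrix (suc n)
    right-inverse k a = proj₁ (u∈X+W a) k

    block·right-inverse : (sub T i j i≤j · right-inverse) ≈M I
    block·right-inverse r a = begin
      ∑ (suc n) (λ k → T (lift r) (shift k) * right-inverse k a)
        ≈⟨ ∑-cong (suc n) (λ k → *-comm (T (lift r) (shift k)) (right-inverse k a)) ⟩
      ∑ (suc n) (λ k → right-inverse k a * T (lift r) (shift k))  ≈⟨ sym (proj₂ (u∈X+W a) (lift r) lift-r≤n) ⟩
      coord (u (lift a)) (lift r)                                   ≈⟨ coord-basis (lift a) (lift r) ⟩
      I (lift a) (lift r)                                           ≈⟨ δ-toℕ (lift a) (lift r) a r (toℕ-fromℕ< _) (toℕ-fromℕ< _) ⟩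
      I a r                                                         ≈⟨ δ-sym a r ⟩
      I r a                                                         ∎
      where
      open SetoidReasoning setoid
      lift-r≤n : toℕ (lift r) ℕ.≤ n
      lift-r≤n = P.subst (ℕ._≤ n) (P.sym (toℕ-fromℕ< _)) (NatProps.≤-pred (toℕ<n r))

    block-invertible : Invertible (sub T i j i≤j)
    block-invertible = right-inverse⇒invertible (suc n) (sub T i j i≤j) right-inverse block·right-inverse

  very-good : VeryGood T
  very-good i j i≤j = Block.block-invertible i j i≤j

lemma5p43 : ∀ {c ℓ m ℓm : Level} (d : ℕ) (F : CommutativeRing c ℓ) → IsField F →
    (V : Module F m ℓm) → LinAlg.HasDimension F V (suc d) →
    (B : Δ d → LinAlg.OneDimSubspace F V) → LinAlg.IsBilliardArray F V d B →
    (u v : Fin (suc d) → Module.Carrierᴹ V) →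
    LinAlg.IsBasis F V u → LinAlg.IsBasis F V v →
    (∀ i → LinAlg._∈₁_ F V (u i) (B (pt-rs i))) →
    (∀ i → LinAlg._∈₁_ F V (v i) (B (pt-rt i))) →
    (T : LinAlg.Matrix F V (suc d)) →
    (∀ j → Module._≈ᴹ_ V (v j)
             (LinAlg.∑ᴹ F V (suc d) (λ i → Module._*ₗ_ V (T i j) (u i)))) →
    LinAlg.VeryGood F V T
lemma5p43 d F isField V _ B billiard u v u-basis v-basis u∈ v∈ T v≈Tu =
  TransitionMatrix.very-good F isField V {d} B billiard u v u-basis v-basis u∈ v∈ T v≈Tu
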